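{- Let $d \ge 2$ and $a$ be integers with $0 < a < d$ and $\gcd(a,d) = 1$, and let $k_i, q_i, \theta'_i$ be the quantities obtained from the extended Euclidean algorithm on $a$ and $d$, as described in the context. Let $b$ be an integer with $0 \le b \le d-1$, and suppose that $b$ is written in the $(\theta'_i)_{i<n}$ number scale as $$ b = \sum_{i=1}^{n+1} b_i \theta'_{i-1}, $$ with $b_{n+1} = 0$ and $b_1, \dots, b_n$ nonnegative integers satisfying the conditions $0 \le b_1 \le k_1 - 1$, $0 \le b_i \le k_i$ for $2 \le i \le n$, and $b_{i+1} = 0$ whenever $b_i = k_i$ (for $1 \le i \le n-1$). Let $$ c = \sum_{i=1}^{n+1} b_i (-1)^{i-1} q_{i-1}. $$ Then $a^{ -1}\cdot b \bmod d \in \{c,\; d + c\}$, where $a^{ -1}\cdot b \bmod d$ denotes the unique integer $x$ with $0 \le x < d$ and $a x \equiv b \pmod d$.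
   Context: Euclidean algorithm data: set $\theta'_{ -1} = d$, $\theta'_0 = a$, and for $i \ge 1$, while $\theta'_{i-1} \neq 0$, put $k_i = \lfloor \theta'_{i-2}/\theta'_{i-1} \rfloor$ and $\theta'_i = \theta'_{i-2} - k_i \theta'_{i-1}$; let $n$ be the index with $\theta'_n = 0$ (so $a/d = [0; k_1, \dots, k_n]$). Define $p_{ -1} = 1$, $p_0 = 0$, $q_{ -1} = 0$, $q_0 = 1$, and $p_i = p_{i-2} + k_i p_{i-1}$, $q_i = q_{i-2} + k_i q_{i-1}$ for $1 \le i \le n$. One has $\theta'_i = (-1)^i (q_i a - p_i d)$. -}

module Defs where

open import Data.Nat using (ℕ; zero; suc; _/_; _%_)
open import Data.List using (List; []; _∷_; length)
open import Data.Integer as ℤ using (ℤ; +_)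

-- Quotients k₁, k₂, … of the Euclidean algorithm started from (θ'₋₁, θ'₀) = (x, y).
-- The fuel argument only bounds the recursion; 'quotients' supplies fuel d+1,
-- which is more than enough (the remainders strictly decrease starting below d).
euclidQuots : ℕ → ℕ → ℕ → List ℕ
euclidQuots zero    x y       = []
euclidQuots (suc f) x zero    = []
euclidQuots (suc f) x (suc y) = (x / suc y) ∷ euclidQuots f (suc y) (x % suc y)

-- The list [k₁, …, kₙ] for a/d (so a/d = [0; k₁, …, kₙ]).
quotients : ℕ → ℕ → List ℕ
quotients d a = euclidQuots (suc d) d a

-- n : the index with θ'ₙ = 0
nSteps : ℕ → ℕ → ℕ
nSteps d a = length (quotients d a)

nth : List ℕ → ℕ → ℕ
nth []       _       = 0
nth (x ∷ xs) zero    = x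
nth (x ∷ xs) (suc i) = nth xs i

-- kᵢ for 1 ≤ i ≤ n (value 0 outside this range, never used there)
kq : ℕ → ℕ → ℕ → ℕ
kq d a zero    = 0
kq d a (suc i) = nth (quotients d a) i

-- Shifted indexing: θS d a j = θ'_{j-1},  qS d a j = q_{j-1}.
θS : ℕ → ℕ → ℕ → ℤ
θS d a zero          = + d
θS d a (suc zero)    = + a
θS d a (suc (suc j)) = θS d a j ℤ.- (+ kq d a (suc j)) ℤ.* θS d a (suc j)

qS : ℕ → ℕ → ℕ → ℤ
qS d a zero          = + 0
qS d a (suc zero)    = + 1
qS d a (suc (suc j)) = qS d a j ℤ.+ (+ kq d a (suc j)) ℤ.* qS d a (suc j)

ΣFrom1 : ℕ → (ℕ → ℤ) → ℤ
ΣFrom1 zero    f = + 0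
ΣFrom1 (suc m) f = ΣFrom1 m f ℤ.+ f (suc m)

sgn : ℕ → ℤ
sgn zero          = + 1
sgn (suc zero)    = ℤ.- (+ 1)
sgn (suc (suc i)) = sgn i

module Submission where

-- The classical identity θ'ᵢ = (-1)ⁱ (qᵢ a - pᵢ d) shows that
--    b = Σ bᵢ θ'ᵢ₋₁ equals a·c + d·t for c = Σ bᵢ (-1)ⁱ⁻¹ qᵢ₋₁ and some t,
--    hence d ∣ a(x - c) and, a being a unit modulo d, d ∣ x - c.
-- 2. Size of c.  With Cₘ the partial sums of c and s = (-1)ᵐ, the digit
--    conditions b₁ < k₁ and bᵢ ≤ kᵢ give  s·Cₘ < qₘ₋₁  and  -s·Cₘ < qₘ  by an
--    induction that uses qₘ₊₁ = qₘ₋₁ + kₘ₊₁ qₘ.  The determinant identity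
--    θ'ᵢ₋₁ qᵢ + θ'ᵢ qᵢ₋₁ = d, together with positivity of the Euclidean
--    remainders, bounds every qᵢ (i ≤ n) by d; so -d < c < d.
-- 3. Window.
--
-- The theorem combines the three.

open import Defs
open import Data.Nat as ℕ using (ℕ; suc; zero; _≤_; _<_; _∸_; z≤n; s≤s)
open import Data.Nat.GCD using (gcd)
open import Data.Integer as ℤ using (ℤ; +_; -[1+_]; +≤+; +<+; -1ℤ; NonNegative)
open import Data.Integer.Divisibility using (_∣_)
open import Data.Sum using (_⊎_; inj₁; inj₂)
open import Data.Product using (_×_; _,_; proj₁; proj₂)
open import Data.List using (List; _∷_; length)
open import Relation.Binary.PropositionalEquality
  using (_≡_; refl; sym; trans; cong; cong₂; subst; subst₂; module ≡-Reasoning)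
import Data.Nat.Properties as ℕP
import Data.Nat.DivMod as ℕDM
import Data.Nat.Coprimality as ℕC
import Data.Integer.Properties as ℤP
import Data.Integer.Coprimality as ℤC
import Data.Integer.Divisibility.Signed as ℤS
open import Data.Integer.Tactic.RingSolver using (solve-∀)

sgn-suc : ∀ j → sgn (suc j) ≡ ℤ.- sgn j
sgn-suc zero          = refl
sgn-suc (suc zero)    = refl
sgn-suc (suc (suc j)) = sgn-suc j

sgn-square : ∀ j → sgn j ℤ.* sgn j ≡ + 1
sgn-square zero          = refl
sgn-square (suc zero)    = refl
sgn-square (suc (suc j)) = sgn-square j

sign-free-bound : ∀ j (y D : ℤ) → sgn j ℤ.* y ℤ.< D → ℤ.- (sgn j ℤ.* y) ℤ.< D →
                  y ℤ.< D × ℤ.- y ℤ.< D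
sign-free-bound zero          y D p n =
  subst (ℤ._< D) (ℤP.*-identityˡ y) p ,
  subst (λ z → ℤ.- z ℤ.< D) (ℤP.*-identityˡ y) n
sign-free-bound (suc zero)    y D p n =
  subst (ℤ._< D) (ℤP.neg-involutive y) (subst (λ z → ℤ.- z ℤ.< D) (ℤP.-1*i≡-i y) n) ,
  subst (ℤ._< D) (ℤP.-1*i≡-i y) p
sign-free-bound (suc (suc j)) y D p n = sign-free-bound j y D p n

-- Numerators of the convergents: pS d a j = p_{j-1}, indexed like qS.
pS : ℕ → ℕ → ℕ → ℤ
pS d a zero          = + 1
pS d a (suc zero)    = + 0
pS d a (suc (suc j)) = pS d a j ℤ.+ (+ kq d a (suc j)) ℤ.* pS d a (suc j)

θ-identity : ∀ d a j →
  θS d a (suc j) ≡ sgn j ℤ.* (qS d a (suc j) ℤ.* + a ℤ.- pS d a (suc j) ℤ.* + d)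
θ-identity d a zero          = base (+ a) (+ d)
  where base : ∀ A D → A ≡ + 1 ℤ.* (+ 1 ℤ.* A ℤ.- + 0 ℤ.* D)
        base = solve-∀
θ-identity d a (suc zero)    = base (+ a) (+ d) (+ kq d a 1)
  where base : ∀ A D K → D ℤ.- K ℤ.* A ≡
                 -1ℤ ℤ.* ((+ 0 ℤ.+ K ℤ.* + 1) ℤ.* A ℤ.- (+ 1 ℤ.+ K ℤ.* + 0) ℤ.* D)
        base = solve-∀
θ-identity d a (suc (suc j)) = begin
  θS d a (suc j) ℤ.- k ℤ.* θS d a (suc (suc j))
    ≡⟨ cong₂ (λ u v → u ℤ.- k ℤ.* v) (θ-identity d a j) (θ-identity d a (suc j)) ⟩
  s ℤ.* (Q₀ ℤ.* A ℤ.- P₀ ℤ.* D) ℤ.- k ℤ.* (sgn (suc j) ℤ.* (Q₁ ℤ.* A ℤ.- P₁ ℤ.* D))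
    ≡⟨ cong (λ t → s ℤ.* (Q₀ ℤ.* A ℤ.- P₀ ℤ.* D) ℤ.- k ℤ.* (t ℤ.* (Q₁ ℤ.* A ℤ.- P₁ ℤ.* D)))
            (sgn-suc j) ⟩
  s ℤ.* (Q₀ ℤ.* A ℤ.- P₀ ℤ.* D) ℤ.- k ℤ.* (ℤ.- s ℤ.* (Q₁ ℤ.* A ℤ.- P₁ ℤ.* D))
    ≡⟨ regroup s Q₀ Q₁ P₀ P₁ k A D ⟩
  s ℤ.* ((Q₀ ℤ.+ k ℤ.* Q₁) ℤ.* A ℤ.- (P₀ ℤ.+ k ℤ.* P₁) ℤ.* D) ∎
  where
  open ≡-Reasoning
  s k A D Q₀ Q₁ P₀ P₁ : ℤ
  s = sgn j
  k = + kq d a (suc (suc j))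
  A = + a
  D = + d
  Q₀ = qS d a (suc j)
  Q₁ = qS d a (suc (suc j))
  P₀ = pS d a (suc j)
  P₁ = pS d a (suc (suc j))
  regroup : ∀ s Q₀ Q₁ P₀ P₁ k A D →
    s ℤ.* (Q₀ ℤ.* A ℤ.- P₀ ℤ.* D) ℤ.- k ℤ.* (ℤ.- s ℤ.* (Q₁ ℤ.* A ℤ.- P₁ ℤ.* D)) ≡
    s ℤ.* ((Q₀ ℤ.+ k ℤ.* Q₁) ℤ.* A ℤ.- (P₀ ℤ.+ k ℤ.* P₁) ℤ.* D)
  regroup = solve-∀

θq-determinant : ∀ d a j → θS d a j ℤ.* qS d a (suc j) ℤ.+ θS d a (suc j) ℤ.* qS d a j ≡ + d
θq-determinant d a zero    = base (+ d) (+ a)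
  where base : ∀ D A → D ℤ.* + 1 ℤ.+ A ℤ.* + 0 ≡ D
        base = solve-∀
θq-determinant d a (suc j) =
  trans (step (θS d a j) (θS d a (suc j)) (qS d a j) (qS d a (suc j)) (+ kq d a (suc j)))
        (θq-determinant d a j)
  where step : ∀ θ₀ θ₁ q₀ q₁ k →
          θ₁ ℤ.* (q₀ ℤ.+ k ℤ.* q₁) ℤ.+ (θ₀ ℤ.- k ℤ.* θ₁) ℤ.* q₁ ≡ θ₀ ℤ.* q₁ ℤ.+ θ₁ ℤ.* q₀
        step = solve-∀

qS-nonneg : ∀ d a j → + 0 ℤ.≤ qS d a j
qS-nonneg d a zero          = +≤+ z≤n
qS-nonneg d a (suc zero)    = +≤+ z≤n
qS-nonneg d a (suc (suc j)) =
  ℤP.+-mono-≤ (qS-nonneg d a j)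
    (subst (ℤ._≤ k ℤ.* qS d a (suc j)) (ℤP.*-zeroʳ k) (ℤP.*-monoˡ-≤-nonNeg k (qS-nonneg d a (suc j))))
  where k = + kq d a (suc j)

remainders : List ℕ → ℤ → ℤ → ℕ → ℤ
remainders ks x y zero          = x
remainders ks x y (suc zero)    = y
remainders ks x y (suc (suc j)) = remainders ks x y j ℤ.- + nth ks j ℤ.* remainders ks x y (suc j)

θS-remainders : ∀ d a j → θS d a j ≡ remainders (quotients d a) (+ d) (+ a) j
θS-remainders d a zero          = refl
θS-remainders d a (suc zero)    = refl
θS-remainders d a (suc (suc j)) =
  cong₂ (λ u v → u ℤ.- + nth (quotients d a) j ℤ.* v) (θS-remainders d a j) (θS-remainders d a (suc j))

remainders-shift : ∀ k ks x y j →
  remainders (k ∷ ks) x y (suc j) ≡ remainders ks y (x ℤ.- + k ℤ.* y) j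
remainders-shift k ks x y zero          = refl
remainders-shift k ks x y (suc zero)    = refl
remainders-shift k ks x y (suc (suc j)) =
  cong₂ (λ u v → u ℤ.- + nth ks j ℤ.* v) (remainders-shift k ks x y j) (remainders-shift k ks x y (suc j))

division-step : ∀ x y → + x ℤ.- + (x ℕDM./ suc y) ℤ.* + suc y ≡ + (x ℕDM.% suc y)
division-step x y = begin
  + x ℤ.- + q ℤ.* + suc y
    ≡⟨ cong (λ m → + m ℤ.- + q ℤ.* + suc y) (ℕDM.m≡m%n+[m/n]*n x (suc y)) ⟩
  + (r ℕ.+ q ℕ.* suc y) ℤ.- + q ℤ.* + suc y
    ≡⟨ cong (λ z → + (r ℕ.+ q ℕ.* suc y) ℤ.- z) (sym (ℤP.pos-* q (suc y))) ⟩
  + r ℤ.+ + (q ℕ.* suc y) ℤ.- + (q ℕ.* suc y)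
    ≡⟨ cancel (+ r) (+ (q ℕ.* suc y)) ⟩
  + r ∎
  where
  open ≡-Reasoning
  q r : ℕ
  q = x ℕDM./ suc y
  r = x ℕDM.% suc y
  cancel : ∀ R B → R ℤ.+ B ℤ.- B ≡ R
  cancel = solve-∀

euclid-remainders-bounds : ∀ f x y j → 0 < x → j ≤ length (euclidQuots f x y) →
  let r = remainders (euclidQuots f x y) (+ x) (+ y) in
  + 1 ℤ.≤ r j × + 0 ℤ.≤ r (suc j)
euclid-remainders-bounds f       x y       zero    0<x _ = +≤+ 0<x , +≤+ z≤n
euclid-remainders-bounds zero    x y       (suc j) _   ()
euclid-remainders-bounds (suc f) x zero    (suc j) _   ()
euclid-remainders-bounds (suc f) x (suc y) (suc j) _   (s≤s j≤n) =
  subst (+ 1 ℤ.≤_) (sym (shifted j)) (proj₁ after-one-step) ,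
  subst (+ 0 ℤ.≤_) (sym (shifted (suc j))) (proj₂ after-one-step)
  where
  ks : List ℕ
  ks = euclidQuots f (suc y) (x ℕDM.% suc y)
  -- after one division step the algorithm continues from (y, x mod y)
  shifted : ∀ i → remainders (euclidQuots (suc f) x (suc y)) (+ x) (+ suc y) (suc i) ≡
                  remainders ks (+ suc y) (+ (x ℕDM.% suc y)) i
  shifted i = trans (remainders-shift (x ℕDM./ suc y) ks (+ x) (+ suc y) i)
                    (cong (λ z → remainders ks (+ suc y) z i) (division-step x y))
  after-one-step : + 1 ℤ.≤ remainders ks (+ suc y) (+ (x ℕDM.% suc y)) j ×
                   + 0 ℤ.≤ remainders ks (+ suc y) (+ (x ℕDM.% suc y)) (suc j)
  after-one-step = euclid-remainders-bounds f (suc y) (x ℕDM.% suc y) j (s≤s z≤n) j≤n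

qS-≤-d : ∀ d a j → 0 < d → j ≤ nSteps d a → qS d a (suc j) ℤ.≤ + d
qS-≤-d d a j 0<d j≤n = begin
  Q₁                         ≡⟨ sym (ℤP.*-identityˡ Q₁) ⟩
  + 1 ℤ.* Q₁                 ≤⟨ ℤP.*-monoʳ-≤-nonNeg Q₁ {{ℤ.nonNegative (qS-nonneg d a (suc j))}} θ₀-pos ⟩
  θ₀ ℤ.* Q₁                  ≤⟨ ℤP.i≤i+j (θ₀ ℤ.* Q₁) (θ₁ ℤ.* Q₀) {{ℤ.nonNegative θ₁Q₀-nonneg}} ⟩
  θ₀ ℤ.* Q₁ ℤ.+ θ₁ ℤ.* Q₀    ≡⟨ θq-determinant d a j ⟩
  + d                        ∎
  where
  open ℤP.≤-Reasoning
  θ₀ θ₁ Q₀ Q₁ : ℤ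
  θ₀ = θS d a j
  θ₁ = θS d a (suc j)
  Q₀ = qS d a j
  Q₁ = qS d a (suc j)
  bounds : + 1 ℤ.≤ remainders (quotients d a) (+ d) (+ a) j ×
           + 0 ℤ.≤ remainders (quotients d a) (+ d) (+ a) (suc j)
  bounds = euclid-remainders-bounds (suc d) d a j 0<d j≤n
  θ₀-pos : + 1 ℤ.≤ θ₀
  θ₀-pos = subst (+ 1 ℤ.≤_) (sym (θS-remainders d a j)) (proj₁ bounds)
  θ₁-nonneg : + 0 ℤ.≤ θ₁
  θ₁-nonneg = subst (+ 0 ℤ.≤_) (sym (θS-remainders d a (suc j))) (proj₂ bounds)
  θ₁Q₀-nonneg : + 0 ℤ.≤ θ₁ ℤ.* Q₀
  θ₁Q₀-nonneg = ℤP.*-monoʳ-≤-nonNeg Q₀ {{ℤ.nonNegative (qS-nonneg d a j)}} θ₁-nonneg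

ΣFrom1-combination : ∀ m (f g h : ℕ → ℤ) (u v : ℤ) →
  (∀ i → f (suc i) ≡ u ℤ.* g (suc i) ℤ.+ v ℤ.* h (suc i)) →
  ΣFrom1 m f ≡ u ℤ.* ΣFrom1 m g ℤ.+ v ℤ.* ΣFrom1 m h
ΣFrom1-combination zero    f g h u v _  = empty u v
  where empty : ∀ u v → + 0 ≡ u ℤ.* + 0 ℤ.+ v ℤ.* + 0
        empty = solve-∀
ΣFrom1-combination (suc m) f g h u v eq =
  trans (cong₂ ℤ._+_ (ΣFrom1-combination m f g h u v eq) (eq m))
        (regroup u v (ΣFrom1 m g) (ΣFrom1 m h) (g (suc m)) (h (suc m)))
  where regroup : ∀ u v G H g h →
          u ℤ.* G ℤ.+ v ℤ.* H ℤ.+ (u ℤ.* g ℤ.+ v ℤ.* h) ≡ u ℤ.* (G ℤ.+ g) ℤ.+ v ℤ.* (H ℤ.+ h)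
        regroup = solve-∀

cSum : ℕ → ℕ → (ℕ → ℕ) → ℕ → ℤ
cSum d a bs m = ΣFrom1 m (λ i → + bs i ℤ.* sgn (i ∸ 1) ℤ.* qS d a i)

cSum-zero-digit : ∀ d a bs m → bs (suc m) ≡ 0 → cSum d a bs (suc m) ≡ cSum d a bs m
cSum-zero-digit d a bs m bₘ₊₁≡0 =
  trans (cong (λ z → cSum d a bs m ℤ.+ + z ℤ.* sgn m ℤ.* qS d a (suc m)) bₘ₊₁≡0)
        (drop (cSum d a bs m) (sgn m) (qS d a (suc m)))
  where drop : ∀ C s q → C ℤ.+ + 0 ℤ.* s ℤ.* q ≡ C
        drop = solve-∀

digit-sum-decomposition : ∀ d a bs m →
  ΣFrom1 m (λ i → + bs i ℤ.* θS d a i) ≡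
  + a ℤ.* cSum d a bs m ℤ.+ + d ℤ.* ΣFrom1 m (λ i → ℤ.- (+ bs i ℤ.* sgn (i ∸ 1) ℤ.* pS d a i))
digit-sum-decomposition d a bs m =
  ΣFrom1-combination m _ _ _ (+ a) (+ d) λ j →
    trans (cong (+ bs (suc j) ℤ.*_) (θ-identity d a j))
          (split (+ bs (suc j)) (sgn j) (qS d a (suc j)) (pS d a (suc j)) (+ a) (+ d))
  where split : ∀ b s Q P A D →
          b ℤ.* (s ℤ.* (Q ℤ.* A ℤ.- P ℤ.* D)) ≡ A ℤ.* (b ℤ.* s ℤ.* Q) ℤ.+ D ℤ.* ℤ.- (b ℤ.* s ℤ.* P)
        split = solve-∀

alternating-step : ∀ (y Q₀ Q₁ : ℤ) {b k} .{{_ : NonNegative Q₁}} → b ≤ k → y ℤ.< Q₀ → ℤ.- y ℤ.< Q₁ →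
  ℤ.- y ℤ.- + b ℤ.* Q₁ ℤ.< Q₁ × y ℤ.+ + b ℤ.* Q₁ ℤ.< Q₀ ℤ.+ + k ℤ.* Q₁
alternating-step y Q₀ Q₁ {b} b≤k y<Q₀ -y<Q₁ =
  ℤP.≤-<-trans (ℤP.i-j≤i (ℤ.- y) (+ b ℤ.* Q₁) {{ℤ.nonNegative bQ₁-nonneg}}) -y<Q₁ ,
  ℤP.+-mono-<-≤ y<Q₀ (ℤP.*-monoʳ-≤-nonNeg Q₁ (+≤+ b≤k))
  where
  bQ₁-nonneg : + 0 ℤ.≤ + b ℤ.* Q₁
  bQ₁-nonneg = ℤP.*-monoʳ-≤-nonNeg Q₁ {+ 0} {+ b} (+≤+ z≤n)

next-signed-sum : ∀ j (C b Q : ℤ) →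
  sgn (suc (suc j)) ℤ.* (C ℤ.+ b ℤ.* sgn (suc j) ℤ.* Q) ≡ ℤ.- (sgn (suc j) ℤ.* C) ℤ.- b ℤ.* Q
next-signed-sum j C b Q = begin
  sgn (suc (suc j)) ℤ.* (C ℤ.+ b ℤ.* s ℤ.* Q)  ≡⟨ cong (ℤ._* (C ℤ.+ b ℤ.* s ℤ.* Q)) (sgn-suc (suc j)) ⟩
  ℤ.- s ℤ.* (C ℤ.+ b ℤ.* s ℤ.* Q)              ≡⟨ expand s C b Q ⟩
  ℤ.- (s ℤ.* C) ℤ.- b ℤ.* (s ℤ.* s) ℤ.* Q      ≡⟨ cong (λ t → ℤ.- (s ℤ.* C) ℤ.- b ℤ.* t ℤ.* Q) (sgn-square (suc j)) ⟩
  ℤ.- (s ℤ.* C) ℤ.- b ℤ.* + 1 ℤ.* Q            ≡⟨ cong (λ t → ℤ.- (s ℤ.* C) ℤ.- t ℤ.* Q) (ℤP.*-identityʳ b) ⟩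
  ℤ.- (s ℤ.* C) ℤ.- b ℤ.* Q                    ∎
  where
  open ≡-Reasoning
  s : ℤ
  s = sgn (suc j)
  expand : ∀ s C b Q → ℤ.- s ℤ.* (C ℤ.+ b ℤ.* s ℤ.* Q) ≡ ℤ.- (s ℤ.* C) ℤ.- b ℤ.* (s ℤ.* s) ℤ.* Q
  expand = solve-∀

signed-partial-sum-bounds : ∀ d a bs → bs 1 < kq d a 1 →
  (∀ i → 2 ≤ i → i ≤ nSteps d a → bs i ≤ kq d a i) →
  ∀ j → suc j ≤ nSteps d a →
  let y = sgn (suc j) ℤ.* cSum d a bs (suc j) in
  y ℤ.< qS d a (suc j) × ℤ.- y ℤ.< qS d a (suc (suc j))
signed-partial-sum-bounds d a bs b₁<k₁ _ zero _ =
  subst (ℤ._< + 1) (first (+ bs 1)) (ℤP.≤-<-trans ℤP.neg-≤-pos (+<+ (s≤s z≤n))) ,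
  subst₂ ℤ._<_ (second (+ bs 1)) (third (+ kq d a 1)) (+<+ b₁<k₁)
  where
  first : ∀ B → ℤ.- B ≡ -1ℤ ℤ.* (+ 0 ℤ.+ B ℤ.* + 1 ℤ.* + 1)
  first = solve-∀
  second : ∀ B → B ≡ ℤ.- (-1ℤ ℤ.* (+ 0 ℤ.+ B ℤ.* + 1 ℤ.* + 1))
  second = solve-∀
  third : ∀ K → K ≡ + 0 ℤ.+ K ℤ.* + 1
  third = solve-∀
signed-partial-sum-bounds d a bs b₁<k₁ bᵢ≤kᵢ (suc j) j<n =
  subst (ℤ._< Q₁) (sym (next-signed-sum j C b Q₁)) (proj₁ step) ,
  subst (ℤ._< Q₀ ℤ.+ k ℤ.* Q₁) (sym (trans (cong ℤ.-_ (next-signed-sum j C b Q₁)) (negate y (b ℤ.* Q₁))))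
        (proj₂ step)
  where
  C y b k Q₀ Q₁ : ℤ
  C = cSum d a bs (suc j)
  y = sgn (suc j) ℤ.* C
  b = + bs (suc (suc j))
  k = + kq d a (suc (suc j))
  Q₀ = qS d a (suc j)
  Q₁ = qS d a (suc (suc j))
  previous : y ℤ.< Q₀ × ℤ.- y ℤ.< Q₁
  previous = signed-partial-sum-bounds d a bs b₁<k₁ bᵢ≤kᵢ j (ℕP.<⇒≤ j<n)
  step : ℤ.- y ℤ.- b ℤ.* Q₁ ℤ.< Q₁ × y ℤ.+ b ℤ.* Q₁ ℤ.< Q₀ ℤ.+ k ℤ.* Q₁
  step = alternating-step y Q₀ Q₁ {{ℤ.nonNegative (qS-nonneg d a (suc (suc j)))}}
           (bᵢ≤kᵢ (suc (suc j)) (s≤s (s≤s z≤n)) j<n) (proj₁ previous) (proj₂ previous)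
  negate : ∀ y z → ℤ.- (ℤ.- y ℤ.- z) ≡ y ℤ.+ z
  negate = solve-∀

partial-sum-bounds : ∀ d a bs → 0 < d → bs 1 < kq d a 1 →
  (∀ i → 2 ≤ i → i ≤ nSteps d a → bs i ≤ kq d a i) →
  ∀ m → 1 ≤ m → m ≤ nSteps d a → ℤ.- (+ d) ℤ.< cSum d a bs m × cSum d a bs m ℤ.< + d
partial-sum-bounds d a bs 0<d b₁<k₁ bᵢ≤kᵢ (suc j) _ j<n =
  subst (ℤ.- (+ d) ℤ.<_) (ℤP.neg-involutive C) (ℤP.neg-mono-< (proj₂ unsigned)) , proj₁ unsigned
  where
  C : ℤ
  C = cSum d a bs (suc j)
  signed : sgn (suc j) ℤ.* C ℤ.< qS d a (suc j) × ℤ.- (sgn (suc j) ℤ.* C) ℤ.< qS d a (suc (suc j))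
  signed = signed-partial-sum-bounds d a bs b₁<k₁ bᵢ≤kᵢ j j<n
  unsigned : C ℤ.< + d × ℤ.- C ℤ.< + d
  unsigned = sign-free-bound (suc j) C (+ d)
               (ℤP.<-≤-trans (proj₁ signed) (qS-≤-d d a j 0<d (ℕP.<⇒≤ j<n)))
               (ℤP.<-≤-trans (proj₂ signed) (qS-≤-d d a (suc j) 0<d j<n))

cancel-unit : ∀ (a d x b c t : ℤ) → ℤC.Coprime d a →
  d ∣ a ℤ.* x ℤ.- b → b ≡ a ℤ.* c ℤ.+ d ℤ.* t → d ∣ x ℤ.- c
cancel-unit a d x b c t coprime d∣ax-b refl =
  ℤC.coprime-divisor d a (x ℤ.- c) coprime (subst (d ∣_) (regroup a x c d t) d∣sum)
  where
  d∣sum : d ∣ (a ℤ.* x ℤ.- (a ℤ.* c ℤ.+ d ℤ.* t)) ℤ.+ d ℤ.* t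
  d∣sum = ℤS.∣⇒∣ᵤ (ℤS.∣m∣n⇒∣m+n (ℤS.∣ᵤ⇒∣ {d} {a ℤ.* x ℤ.- (a ℤ.* c ℤ.+ d ℤ.* t)} d∣ax-b)
                                (ℤS.∣m⇒∣m*n t ℤS.∣-refl))
  regroup : ∀ a x c d t → (a ℤ.* x ℤ.- (a ℤ.* c ℤ.+ d ℤ.* t)) ℤ.+ d ℤ.* t ≡ a ℤ.* (x ℤ.- c)
  regroup = solve-∀

between-minus-one-and-two : ∀ w → -1ℤ ℤ.< w → w ℤ.< + 2 → w ≡ + 0 ⊎ w ≡ + 1
between-minus-one-and-two (+ 0)           _          _ = inj₁ refl
between-minus-one-and-two (+ 1)           _          _ = inj₂ refl
between-minus-one-and-two (+ suc (suc k)) _          (+<+ (s≤s (s≤s ())))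
between-minus-one-and-two -[1+ k ]        (ℤ.-<- ()) _

closest-representatives : ∀ {x c : ℤ} d → + 0 ℤ.≤ x → x ℤ.< + d →
  ℤ.- (+ d) ℤ.< c → c ℤ.< + d → + d ∣ x ℤ.- c → x ≡ c ⊎ x ≡ + d ℤ.+ c
closest-representatives {x} {c} d 0≤x x<d -d<c c<d d∣x-c =
  conclude (between-minus-one-and-two w (ℤP.*-cancelʳ-<-nonNeg (+ d) lower)
                                        (ℤP.*-cancelʳ-<-nonNeg (+ d) upper))
  where
  open ℤS._∣_ (ℤS.∣ᵤ⇒∣ {+ d} {x ℤ.- c} d∣x-c) renaming (quotient to w; equality to x-c≡wd)
  lower : -1ℤ ℤ.* + d ℤ.< w ℤ.* + d
  lower = begin-strict
    -1ℤ ℤ.* + d         ≡⟨ ℤP.-1*i≡-i (+ d) ⟩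
    ℤ.- (+ d)           ≡⟨ sym (ℤP.+-identityˡ (ℤ.- (+ d))) ⟩
    + 0 ℤ.+ ℤ.- (+ d)   <⟨ ℤP.+-mono-≤-< 0≤x (ℤP.neg-mono-< c<d) ⟩
    x ℤ.- c             ≡⟨ x-c≡wd ⟩
    w ℤ.* + d           ∎
    where open ℤP.≤-Reasoning
  upper : w ℤ.* + d ℤ.< + 2 ℤ.* + d
  upper = begin-strict
    w ℤ.* + d           ≡⟨ sym x-c≡wd ⟩
    x ℤ.- c             <⟨ ℤP.+-mono-< x<d (subst (ℤ.- c ℤ.<_) (ℤP.neg-involutive (+ d)) (ℤP.neg-mono-< -d<c)) ⟩
    + d ℤ.+ + d         ≡⟨ double (+ d) ⟩
    + 2 ℤ.* + d         ∎
    where open ℤP.≤-Reasoning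
          double : ∀ D → D ℤ.+ D ≡ + 2 ℤ.* D
          double = solve-∀
  x≡wd+c : x ≡ w ℤ.* + d ℤ.+ c
  x≡wd+c = trans (restore x c) (cong (ℤ._+ c) x-c≡wd)
    where restore : ∀ x c → x ≡ (x ℤ.- c) ℤ.+ c
          restore = solve-∀
  conclude : w ≡ + 0 ⊎ w ≡ + 1 → x ≡ c ⊎ x ≡ + d ℤ.+ c
  conclude (inj₁ w≡0) =
    inj₁ (trans x≡wd+c (trans (cong (λ v → v ℤ.* + d ℤ.+ c) w≡0) (ℤP.+-identityˡ c)))
  conclude (inj₂ w≡1) =
    inj₂ (trans x≡wd+c (trans (cong (λ v → v ℤ.* + d ℤ.+ c) w≡1) (cong (ℤ._+ c) (ℤP.*-identityˡ (+ d)))))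

theorem2 : (d a : ℕ) → 2 ≤ d → 0 < a → a < d → gcd a d ≡ 1 →
    (b : ℕ) → b ≤ d ∸ 1 →
    (bs : ℕ → ℕ) →
    bs (suc (nSteps d a)) ≡ 0 →
    bs 1 ≤ kq d a 1 ∸ 1 →
    (∀ i → 2 ≤ i → i ≤ nSteps d a → bs i ≤ kq d a i) →
    (∀ i → 1 ≤ i → i ≤ nSteps d a ∸ 1 → bs i ≡ kq d a i → bs (suc i) ≡ 0) →
    + b ≡ ΣFrom1 (suc (nSteps d a)) (λ i → + bs i ℤ.* θS d a i) →
    (x : ℕ) → x < d → (+ d) ∣ ((+ a) ℤ.* (+ x) ℤ.- (+ b)) →
    let c = ΣFrom1 (suc (nSteps d a)) (λ i → + bs i ℤ.* sgn (i ∸ 1) ℤ.* qS d a i) in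
    (+ x ≡ c) ⊎ (+ x ≡ + d ℤ.+ c)
theorem2 d (suc a') 2≤d _ a<d gcd≡1 b _ bs last-digit-zero b₁≤k₁-1 bᵢ≤kᵢ _ b-expansion x x<d d∣ax-b =
  closest-representatives d (+≤+ z≤n) (+<+ x<d) (proj₁ c-bounds) (proj₂ c-bounds) d∣x-c
  where
  a n : ℕ
  a = suc a'
  n = nSteps d a
  -- k₁ = ⌊d/a⌋ ≥ 1, so the first digit condition says b₁ < k₁
  b₁<k₁ : bs 1 < kq d a 1
  b₁<k₁ = ℕP.m≤pred[n]⇒suc[m]≤n {{ℕ.>-nonZero (ℕDM.m≥n⇒m/n>0 (ℕP.<⇒≤ a<d))}} b₁≤k₁-1
  -- c = Cₙ₊₁ = Cₙ (as bₙ₊₁ = 0) lies strictly between -d and d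
  c-bounds : ℤ.- (+ d) ℤ.< cSum d a bs (suc n) × cSum d a bs (suc n) ℤ.< + d
  c-bounds = subst (λ C → ℤ.- (+ d) ℤ.< C × C ℤ.< + d) (sym (cSum-zero-digit d a bs n last-digit-zero))
               (partial-sum-bounds d a bs (ℕP.<-≤-trans (s≤s z≤n) 2≤d) b₁<k₁ bᵢ≤kᵢ n (s≤s z≤n) ℕP.≤-refl)
  d∣x-c : + d ∣ + x ℤ.- cSum d a bs (suc n)
  d∣x-c = cancel-unit (+ a) (+ d) (+ x) (+ b) (cSum d a bs (suc n)) _
            (ℕC.sym (ℕC.gcd≡1⇒coprime gcd≡1)) d∣ax-b
            (trans b-expansion (digit-sum-decomposition d a bs (suc n)))
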